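{- Let $\mu_4$ be the morphism on the alphabet $\{0,1,\dots,9,a,b,c,d,e,f,g,h\}$ defined by $0\mapsto 01$, $1\mapsto 2$, $2\mapsto 34$, $3\mapsto 56$, $4\mapsto 7$, $5\mapsto 89$, $6\mapsto a$, $7\mapsto bc$, $8\mapsto dc$, $9\mapsto d$, $a\mapsto ef$, $b\mapsto ef$, $c\mapsto e$, $d\mapsto 7g$, $e\mapsto eh$, $f\mapsto b$, $g\mapsto d$, $h\mapsto b$, and let $\rho_4$ be the coding $0,3,7,8,9,b,c,d,e,h\mapsto 1$; $1,2,a\mapsto 2$; $4,5,6,f,g\mapsto 0$. Let $g_4(n)$ be the $n$-th symbol (indexing from $0$) of the infinite word $\rho_4(\mu_4^\omega(0))$, where $\mu_4^\omega(0)$ is the fixed point of $\mu_4$ starting with $0$. Then a position $(a,b)$ with $a\le b$ is a $\mathcal{P}$-position of $K^4$ if and only if either $a+b\le 4$, or there exists $n\ge 0$ with \[ a=\lfloor (n+2)\phi\rfloor+g_4(n+1)\quad\text{and}\quad b=\lfloor (n+2)\phi^2\rfloor+g_4(n+1)+3 . \]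
   Context: $\phi=(1+\sqrt5)/2$. Positions are pairs $(x,y)\in\mathbb{N}^2$. A Wythoff move from $(x,y)$ leads to $(x-i,y)$ with $1\le i\le x$, to $(x,y-i)$ with $1\le i\le y$, or to $(x-i,y-i)$ with $1\le i\le\min(x,y)$. For $\ell\in\mathbb{N}$, $K^\ell$ is the two-player impartial game with Wythoff moves in which the positions of $\{(x,y): x+y\le\ell\}$ are terminal: no move is allowed from a terminal position, and a player who moves into a terminal position wins (normal play). A $\mathcal{P}$-position is a position from which the previous player has a winning strategy; terminal positions are $\mathcal{P}$-positions. -}

module Defs where

open import Data.Nat using (ℕ; zero; suc; _+_; _*_; _∸_; _/_; _≤_; _<_; _≤ᵇ_)
open import Data.Bool using (if_then_else_)
open import Data.List using (List; []; _∷_; concatMap)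

-- Golden ratio floors, computed exactly over ℕ.
-- n·φ = (n + √(5n²))/2 and n·φ² = (3n + √(5n²))/2, and for an integer m
-- and real x ≥ 0, ⌊(m + x)/2⌋ = ⌊(m + ⌊x⌋)/2⌋.

isqrt : ℕ → ℕ
isqrt zero = zero
isqrt (suc m) with isqrt m
... | r = if suc r * suc r ≤ᵇ suc m then suc r else r

floorPhi : ℕ → ℕ
floorPhi n = (n + isqrt (5 * (n * n))) / 2

floorPhi2 : ℕ → ℕ
floorPhi2 n = (3 * n + isqrt (5 * (n * n))) / 2

data Letter : Set where
  l0 l1 l2 l3 l4 l5 l6 l7 l8 l9 la lb lc ld le lf lg lh : Letter

μ₄ : Letter → List Letter
μ₄ l0 = l0 ∷ l1 ∷ []
μ₄ l1 = l2 ∷ []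
μ₄ l2 = l3 ∷ l4 ∷ []
μ₄ l3 = l5 ∷ l6 ∷ []
μ₄ l4 = l7 ∷ []
μ₄ l5 = l8 ∷ l9 ∷ []
μ₄ l6 = la ∷ []
μ₄ l7 = lb ∷ lc ∷ []
μ₄ l8 = ld ∷ lc ∷ []
μ₄ l9 = ld ∷ []
μ₄ la = le ∷ lf ∷ []
μ₄ lb = le ∷ lf ∷ []
μ₄ lc = le ∷ []
μ₄ ld = l7 ∷ lg ∷ []
μ₄ le = le ∷ lh ∷ []
μ₄ lf = lb ∷ []
μ₄ lg = ld ∷ []
μ₄ lh = lb ∷ []

ρ₄ : Letter → ℕ
ρ₄ l0 = 1
ρ₄ l3 = 1
ρ₄ l7 = 1
ρ₄ l8 = 1
ρ₄ l9 = 1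
ρ₄ lb = 1
ρ₄ lc = 1
ρ₄ ld = 1
ρ₄ le = 1
ρ₄ lh = 1
ρ₄ l1 = 2
ρ₄ l2 = 2
ρ₄ la = 2
ρ₄ l4 = 0
ρ₄ l5 = 0
ρ₄ l6 = 0
ρ₄ lf = 0
ρ₄ lg = 0

μ₄* : List Letter → List Letter
μ₄* = concatMap μ₄

iter : ℕ → List Letter → List Letter
iter zero w = w
iter (suc k) w = μ₄* (iter k w)

nth : ℕ → List Letter → Letter
nth _ [] = l0
nth zero (x ∷ _) = x
nth (suc k) (_ ∷ xs) = nth k xs

-- n-th letter (from 0) of the fixed point μ₄^ω(0). Since μ₄(0) = 01 and
-- μ₄ is non-erasing, μ₄ᵏ(0) is a prefix of μ₄^ω(0) of length ≥ k+1,
-- so the default of nth is never used.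
fixpt : ℕ → Letter
fixpt n = nth n (iter (suc n) (l0 ∷ []))

g₄ : ℕ → ℕ
g₄ n = ρ₄ (fixpt n)

data Move : ℕ → ℕ → ℕ → ℕ → Set where
  moveX  : ∀ {x y i} → 1 ≤ i → i ≤ x → Move x y (x ∸ i) y
  moveY  : ∀ {x y i} → 1 ≤ i → i ≤ y → Move x y x (y ∸ i)
  moveXY : ∀ {x y i} → 1 ≤ i → i ≤ x → i ≤ y → Move x y (x ∸ i) (y ∸ i)

-- P- and N-positions of K^ℓ (normal play; positions with x + y ≤ ℓ are
-- terminal, no move from them, and they are P-positions).
mutual
  data IsP (ℓ : ℕ) : ℕ → ℕ → Set where
    terminal : ∀ {x y} → x + y ≤ ℓ → IsP ℓ x y
    allToN   : ∀ {x y} → ℓ < x + y →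
               (∀ {x' y'} → Move x y x' y' → IsN ℓ x' y') → IsP ℓ x y

  data IsN (ℓ : ℕ) : ℕ → ℕ → Set where
    someToP : ∀ {x y x' y'} → ℓ < x + y →
              Move x y x' y' → IsP ℓ x' y' → IsN ℓ x y

{-# OPTIONS --safe #-}
-- The P-positions of K^ℓ form the kernel of its game graph: the set containing the terminal
-- positions, with no move between two of its non-terminal members, and reachable in one move from
-- every other non-terminal position.  For ℓ = 4 the kernel consists of the terminal positions and
-- the pairs (a n, b n = a n + n + 5) with their mirror images, as soon as a is increasing, a 0 = 5
-- and a, b partition the integers above 4.  The partition follows from local facts:
-- a (a n − 1) < b n < a (a n), a (j + 1) ≤ a j + 2, and a gap of 2 after a j forces j + 1 to be a
-- value of a.  Writing a n = α (n + 1) with α k = pos k + 1 + ρ₄ (w k), where pos k is the start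
-- of the block μ₄ (w k) in the fixed point w, these facts are read off a finite set of length-5
-- factors of w that is closed under μ₄ and checked by computation.  Finally pos k + 1 = ⌊(k+1)φ⌋
-- because the block lengths form the Fibonacci word, which reduces to Beatty identities such as
-- ⌊⌊mφ⌋φ⌋ = ⌊mφ⌋ + m − 1, proved by exact integer comparisons with √5.
module Submission where

open import Defs
open import Data.Nat using (ℕ; _+_; _≤_)
open import Data.Product using (∃-syntax; _×_)
open import Data.Sum using (_⊎_)
open import Function.Bundles using (_⇔_)
open import Relation.Binary.PropositionalEquality using (_≡_)

open import Data.Nat
  using (zero; suc; pred; _∸_; _*_; _/_; _%_; _<_; _≤?_; _<?_; _≤ᵇ_; s≤s; z≤n; NonZero; ≢-nonZero⁻¹; >-nonZero)
open import Data.Nat.Properties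
open import Data.Nat.DivMod using (m≡m%n+[m/n]*n; m%n<n; m*n/n≡m; m<n⇒m/n≡0; +-distrib-/-∣ʳ)
open import Data.Nat.Divisibility using (_∣_; divides)
open import Data.Nat.Primality using (prime?; euclidsLemma)
open import Data.Nat.Induction using (<-rec)
open import Data.Nat.Tactic.RingSolver using (solve-∀)
open import Data.Bool using (true; false; T)
open import Data.Unit using (tt)
open import Data.Empty using (⊥-elim)
open import Data.Product using (_,_; proj₁; proj₂; ∃₂)
open import Data.Sum using (inj₁; inj₂; map₂; [_,_]′) renaming (map to ⊎-map)
open import Data.Fin using (Fin; #_)
import Data.Fin.Properties as Fin
open import Data.Vec using (Vec; lookup) renaming (_∷_ to _∷ᵛ_; [] to []ᵛ)
open import Data.List using (List; []; _∷_; _++_; length; take; drop)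
import Data.List.Properties as List
open import Data.List.Relation.Unary.All using (All; all?) renaming (lookup to All-lookup)
open import Function.Base using (_∘_)
open import Function.Bundles using (mk⇔; Equivalence)
open import Function.Properties.Equivalence using () renaming (trans to ⇔-trans)
open import Relation.Binary using (DecidableEquality; tri<; tri≈; tri>)
open import Relation.Binary.PropositionalEquality
  using (_≢_; refl; sym; trans; cong; cong₂; subst; subst₂; module ≡-Reasoning)
open import Relation.Nullary using (¬_; Dec; yes; no)
open import Relation.Nullary.Decidable
  using (toWitness; from-yes; True; map′; _→-dec_; _×-dec_; _⊎-dec_)
open import Relation.Unary using (Decidable)

-- Moves and the kernel of K^ℓ

move-decreases : ∀ {x y x' y'} → Move x y x' y' → x' + y' < x + y
move-decreases (moveX 0<i i≤x) = +-monoˡ-< _ (∸-monoʳ-< 0<i i≤x)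
move-decreases (moveY 0<i i≤y) = +-monoʳ-< _ (∸-monoʳ-< 0<i i≤y)
move-decreases (moveXY 0<i i≤x i≤y) = +-mono-< (∸-monoʳ-< 0<i i≤x) (∸-monoʳ-< 0<i i≤y)

move-swap : ∀ {x y x' y'} → Move x y x' y' → Move y x y' x'
move-swap (moveX 0<i i≤x) = moveY 0<i i≤x
move-swap (moveY 0<i i≤y) = moveX 0<i i≤y
move-swap (moveXY 0<i i≤x i≤y) = moveXY 0<i i≤y i≤x

move-y : ∀ {x y t} → t < y → Move x y x t
move-y {y = y} {t} t<y = subst (Move _ y _) (m∸[m∸n]≡n (<⇒≤ t<y)) (moveY (m<n⇒0<n∸m t<y) (m∸n≤m y t))

move-diag : ∀ {x y t u} → t < x → t + y ≡ u + x → Move x y t u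
move-diag {x} {y} {t} {u} t<x t+y≡u+x =
  subst₂ (Move x y) (m∸[m∸n]≡n (<⇒≤ t<x)) y∸d≡u (moveXY (m<n⇒0<n∸m t<x) (m∸n≤m x t) d≤y)
  where
  d : ℕ
  d = x ∸ t
  y≡u+d : y ≡ u + d
  y≡u+d = +-cancelˡ-≡ t _ _ (begin
    t + y        ≡⟨ t+y≡u+x ⟩
    u + x        ≡⟨ cong (u +_) (sym (m+[n∸m]≡n (<⇒≤ t<x))) ⟩
    u + (t + d)  ≡⟨ +-comm-middle u t d ⟩
    t + (u + d)  ∎)
    where
    open ≡-Reasoning
    +-comm-middle : ∀ u t d → u + (t + d) ≡ t + (u + d)
    +-comm-middle = solve-∀
  y∸d≡u : y ∸ d ≡ u
  y∸d≡u = trans (cong (_∸ d) y≡u+d) (m+n∸n≡m u d)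
  d≤y : d ≤ y
  d≤y = subst (d ≤_) (sym y≡u+d) (m≤n+m d u)

data MoveView (x y x' y' : ℕ) : Set where
  horizontal : x' < x → y' ≡ y → MoveView x y x' y'
  vertical   : x' ≡ x → y' < y → MoveView x y x' y'
  diagonal   : x' < x → y' < y → x' + y ≡ y' + x → MoveView x y x' y'

move-view : ∀ {x y x' y'} → Move x y x' y' → MoveView x y x' y'
move-view (moveX 0<i i≤x) = horizontal (∸-monoʳ-< 0<i i≤x) refl
move-view (moveY 0<i i≤y) = vertical refl (∸-monoʳ-< 0<i i≤y)
move-view {x} {y} (moveXY {i = i} 0<i i≤x i≤y) =
  diagonal (∸-monoʳ-< 0<i i≤x) (∸-monoʳ-< 0<i i≤y) (+-cancelʳ-≡ i _ _ (begin
    x ∸ i + y + i    ≡⟨ +-comm-right (x ∸ i) y i ⟩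
    x ∸ i + i + y    ≡⟨ cong (_+ y) (m∸n+n≡m i≤x) ⟩
    x + y            ≡⟨ +-comm x y ⟩
    y + x            ≡⟨ cong (_+ x) (sym (m∸n+n≡m i≤y)) ⟩
    y ∸ i + i + x    ≡⟨ +-comm-right (y ∸ i) i x ⟩
    y ∸ i + x + i    ∎))
  where
  open ≡-Reasoning
  +-comm-right : ∀ m n o → m + n + o ≡ m + o + n
  +-comm-right = solve-∀

IsP⇒¬IsN : ∀ {ℓ x y} → IsP ℓ x y → ¬ IsN ℓ x y
IsP⇒¬IsN (terminal x+y≤ℓ) (someToP ℓ<x+y _ _) = <⇒≱ ℓ<x+y x+y≤ℓ
IsP⇒¬IsN (allToN _ toN) (someToP _ mv isP) = IsP⇒¬IsN isP (toN mv)

module Kernel (ℓ : ℕ) (S : ℕ → ℕ → Set)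
  (terminal⇒S : ∀ {x y} → x + y ≤ ℓ → S x y)
  (independent : ∀ {x y x' y'} → S x y → ℓ < x + y → Move x y x' y' → ¬ S x' y')
  (absorbing : ∀ {x y} → ℓ < x + y → S x y ⊎ ∃₂ λ x' y' → Move x y x' y' × S x' y')
  where

  private
    IsP⇔S-below : ∀ bound {x y} → x + y < bound → (IsP ℓ x y → S x y) × (S x y → IsP ℓ x y)
    IsP⇔S-below (suc bound) {x} {y} x+y≤bound = IsP⇒S , S⇒IsP
      where
      IH : ∀ {x' y'} → x' + y' < x + y → (IsP ℓ x' y' → S x' y') × (S x' y' → IsP ℓ x' y')
      IH lt = IsP⇔S-below bound (<-≤-trans lt (≤-pred x+y≤bound))

      outside⇒IsN : ∀ {x' y'} → x' + y' < x + y → ¬ S x' y' → IsN ℓ x' y'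
      outside⇒IsN lt x'y'∉S with ℓ<x'+y' ← ≰⇒> (λ t → x'y'∉S (terminal⇒S t)) | absorbing ℓ<x'+y'
      ... | inj₁ x'y'∈S = ⊥-elim (x'y'∉S x'y'∈S)
      ... | inj₂ (_ , _ , mv , ∈S) = someToP ℓ<x'+y' mv (proj₂ (IH (<-trans (move-decreases mv) lt)) ∈S)

      IsP⇒S : IsP ℓ x y → S x y
      IsP⇒S (terminal x+y≤ℓ) = terminal⇒S x+y≤ℓ
      IsP⇒S (allToN ℓ<x+y toN) with absorbing ℓ<x+y
      ... | inj₁ xy∈S = xy∈S
      ... | inj₂ (_ , _ , mv , ∈S) = ⊥-elim (IsP⇒¬IsN (proj₂ (IH (move-decreases mv)) ∈S) (toN mv))

      S⇒IsP : S x y → IsP ℓ x y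
      S⇒IsP xy∈S with x + y ≤? ℓ
      ... | yes x+y≤ℓ = terminal x+y≤ℓ
      ... | no x+y≰ℓ = allToN (≰⇒> x+y≰ℓ) λ mv →
        outside⇒IsN (move-decreases mv) (independent xy∈S (≰⇒> x+y≰ℓ) mv)

  IsP⇔S : ∀ x y → IsP ℓ x y ⇔ S x y
  IsP⇔S x y = mk⇔ (proj₁ both) (proj₂ both)
    where
    both : (IsP ℓ x y → S x y) × (S x y → IsP ℓ x y)
    both = IsP⇔S-below (suc (x + y)) ≤-refl

strictMono⇒injective : ∀ {f : ℕ → ℕ} → (∀ {m n} → m < n → f m < f n) → ∀ {m n} → f m ≡ f n → m ≡ n
strictMono⇒injective f-mono {m} {n} fm≡fn with <-cmp m n
... | tri< m<n _ _ = ⊥-elim (<⇒≢ (f-mono m<n) fm≡fn)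
... | tri≈ _ m≡n _ = m≡n
... | tri> _ _ n<m = ⊥-elim (<⇒≢ (f-mono n<m) (sym fm≡fn))

bracket : ∀ (f : ℕ → ℕ) → (∀ n → f n < f (suc n)) → ∀ N → f 0 ≤ N → ∃[ j ] f j ≤ N × N < f (suc j)
bracket f f-mono N f₀≤N with m≤n⇒m<n∨m≡n f₀≤N
... | inj₂ refl = 0 , ≤-refl , f-mono 0
bracket f f-mono (suc N) _ | inj₁ f₀<1+N with bracket f f-mono N (≤-pred f₀<1+N)
... | j , fj≤N , N<fj+1 with m≤n⇒m<n∨m≡n N<fj+1
...   | inj₁ 1+N<fj+1 = j , m≤n⇒m≤1+n fj≤N , 1+N<fj+1
...   | inj₂ 1+N≡fj+1 = suc j , ≤-reflexive (sym 1+N≡fj+1) , subst (_< f (suc (suc j))) (sym 1+N≡fj+1) (f-mono (suc j))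

m<n<m+2⇒n≡1+m : ∀ {m n} → m < n → n < m + 2 → n ≡ suc m
m<n<m+2⇒n≡1+m {m} {n} m<n n<m+2 = ≤-antisym (≤-pred (subst (n <_) (+-comm m 2) n<m+2)) m<n

-- Wythoff-type pairs

module WythoffPairs (ℓ : ℕ) (a : ℕ → ℕ) (a-mono : ∀ n → a n < a (suc n)) where

  b : ℕ → ℕ
  b n = a n + n + suc ℓ

  a-mono-< : ∀ {m n} → m < n → a m < a n
  a-mono-< {m} {suc n} m<1+n with m≤n⇒m<n∨m≡n (≤-pred m<1+n)
  ... | inj₁ m<n = <-trans (a-mono-< m<n) (a-mono n)
  ... | inj₂ refl = a-mono m

  a-mono-≤ : ∀ {m n} → m ≤ n → a m ≤ a n
  a-mono-≤ m≤n with m≤n⇒m<n∨m≡n m≤n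
  ... | inj₁ m<n = <⇒≤ (a-mono-< m<n)
  ... | inj₂ refl = ≤-refl

  a-cancel-< : ∀ {m n} → a m < a n → m < n
  a-cancel-< {m} {n} am<an with m <? n
  ... | yes m<n = m<n
  ... | no m≮n = ⊥-elim (<⇒≱ am<an (a-mono-≤ (≮⇒≥ m≮n)))

  a-injective : ∀ {m n} → a m ≡ a n → m ≡ n
  a-injective = strictMono⇒injective a-mono-<

  b-injective : ∀ {m n} → b m ≡ b n → m ≡ n
  b-injective = strictMono⇒injective λ m<n → +-monoˡ-< (suc ℓ) (+-mono-< (a-mono-< m<n) m<n)

  b≡a+ : ∀ n → b n ≡ a n + (n + suc ℓ)
  b≡a+ n = +-assoc (a n) n (suc ℓ)

  a<b : ∀ n → a n < b n
  a<b n = subst (a n <_) (sym (b≡a+ n)) (m<m+n (a n) (subst (0 <_) (sym (+-suc n ℓ)) (s≤s z≤n)))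

  𝒫 : ℕ → ℕ → Set
  𝒫 x y = x + y ≤ ℓ ⊎ (∃[ n ] x ≡ a n × y ≡ b n) ⊎ (∃[ n ] x ≡ b n × y ≡ a n)

  𝒫-swap : ∀ {x y} → 𝒫 x y → 𝒫 y x
  𝒫-swap {x} {y} (inj₁ x+y≤ℓ) = inj₁ (subst (_≤ ℓ) (+-comm x y) x+y≤ℓ)
  𝒫-swap (inj₂ (inj₁ (n , x≡a , y≡b))) = inj₂ (inj₂ (n , y≡b , x≡a))
  𝒫-swap (inj₂ (inj₂ (n , x≡b , y≡a))) = inj₂ (inj₁ (n , y≡a , x≡b))

  module Game (ℓ<a₀ : ℓ < a 0) (a≢b : ∀ m n → a m ≢ b n)
    (cover : ∀ N → ℓ < N → (∃[ n ] a n ≡ N) ⊎ (∃[ n ] b n ≡ N)) where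

    ℓ<a : ∀ n → ℓ < a n
    ℓ<a zero = ℓ<a₀
    ℓ<a (suc n) = <-trans (ℓ<a n) (a-mono n)

    ℓ<b : ∀ n → ℓ < b n
    ℓ<b n = <-trans (ℓ<a n) (a<b n)

    nonterminal : ∀ x y → ℓ < x ⊎ ℓ < y → ¬ x + y ≤ ℓ
    nonterminal x y (inj₁ ℓ<x) = <⇒≱ (<-≤-trans ℓ<x (m≤m+n x y))
    nonterminal x y (inj₂ ℓ<y) = <⇒≱ (<-≤-trans ℓ<y (m≤n+m y x))

    pair-diagonal : ∀ {n x' y'} → x' + b n ≡ y' + a n → y' ≡ x' + (n + suc ℓ)
    pair-diagonal {n} {x'} {y'} x'+bn≡y'+an = +-cancelˡ-≡ (a n) _ _ (begin
      a n + y'               ≡⟨ +-comm (a n) y' ⟩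
      y' + a n               ≡⟨ sym x'+bn≡y'+an ⟩
      x' + b n               ≡⟨ cong (x' +_) (b≡a+ n) ⟩
      x' + (a n + (n + suc ℓ)) ≡⟨ +-comm-left x' (a n) _ ⟩
      a n + (x' + (n + suc ℓ)) ∎)
      where
      open ≡-Reasoning
      +-comm-left : ∀ m n o → m + (n + o) ≡ n + (m + o)
      +-comm-left = solve-∀

    pair-independent : ∀ {n x' y'} → Move (a n) (b n) x' y' → ¬ 𝒫 x' y'
    pair-independent {n} mv with move-view mv
    pair-independent {n} {x'} mv | horizontal x'<an refl = λ where
      (inj₁ x'+y'≤ℓ) → nonterminal x' (b n) (inj₂ (ℓ<b n)) x'+y'≤ℓ
      (inj₂ (inj₁ (m , x'≡am , bn≡bm))) → <⇒≢ x'<an (trans x'≡am (cong a (sym (b-injective bn≡bm))))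
      (inj₂ (inj₂ (m , _ , bn≡am))) → a≢b m n (sym bn≡am)
    pair-independent {n} {_} {y'} mv | vertical refl y'<bn = λ where
      (inj₁ x'+y'≤ℓ) → nonterminal (a n) y' (inj₁ (ℓ<a n)) x'+y'≤ℓ
      (inj₂ (inj₁ (m , an≡am , y'≡bm))) → <⇒≢ y'<bn (trans y'≡bm (cong b (sym (a-injective an≡am))))
      (inj₂ (inj₂ (m , an≡bm , _))) → a≢b n m an≡bm
    pair-independent {n} {x'} mv | diagonal x'<an _ x'+bn≡y'+an
      with refl ← pair-diagonal {n} {x'} x'+bn≡y'+an = λ where
      (inj₁ x'+y'≤ℓ) → nonterminal x' _ (inj₂ (≤-trans (m≤n+m (suc ℓ) n) (m≤n+m _ x'))) x'+y'≤ℓ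
      (inj₂ (inj₁ (m , refl , y'≡bm))) →
        <⇒≢ x'<an (cong a (sym (+-cancelʳ-≡ (suc ℓ) n m (+-cancelˡ-≡ (a m) _ _ (trans y'≡bm (b≡a+ m))))))
      (inj₂ (inj₂ (m , refl , y'≡am))) → <⇒≱ (a<b m) (≤-trans (m≤m+n (b m) _) (≤-reflexive y'≡am))

    𝒫-independent : ∀ {x y x' y'} → 𝒫 x y → ℓ < x + y → Move x y x' y' → ¬ 𝒫 x' y'
    𝒫-independent (inj₁ x+y≤ℓ) ℓ<x+y _ = ⊥-elim (<⇒≱ ℓ<x+y x+y≤ℓ)
    𝒫-independent (inj₂ (inj₁ (n , refl , refl))) _ mv = pair-independent mv
    𝒫-independent (inj₂ (inj₂ (n , refl , refl))) _ mv x'y'∈𝒫 = pair-independent (move-swap mv) (𝒫-swap x'y'∈𝒫)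

    Absorbed : ℕ → ℕ → Set
    Absorbed x y = 𝒫 x y ⊎ ∃₂ λ x' y' → Move x y x' y' × 𝒫 x' y'

    absorbing-≤ : ∀ {x y} → x ≤ y → ℓ < x + y → Absorbed x y
    absorbing-≤ {x} x≤y ℓ<x+y with m≤n⇒∃[o]m+o≡n x≤y
    ... | d , refl with x ≤? ℓ | d ≤? ℓ
    ... | yes x≤ℓ | _ = inj₂ (x , 0 , move-y 0<y , inj₁ (subst (_≤ ℓ) (sym (+-identityʳ x)) x≤ℓ))
      where
      0<y : 0 < x + d
      0<y = ≰⇒> λ y≤0 → <⇒≱ ℓ<x+y (≤-trans (+-monoʳ-≤ x y≤0) (subst (_≤ ℓ) (sym (+-identityʳ x)) x≤ℓ))
    ... | no x≰ℓ | yes d≤ℓ =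
      inj₂ (0 , d , move-diag (<-≤-trans (s≤s z≤n) (≰⇒> x≰ℓ)) (+-comm x d) , inj₁ d≤ℓ)
    ... | no x≰ℓ | no d≰ℓ with cover x (≰⇒> x≰ℓ)
    ...   | inj₂ (n , refl) =
      inj₂ (b n , a n , move-y (<-≤-trans (a<b n) (m≤m+n (b n) d)) , inj₂ (inj₂ (n , refl , refl)))
    ...   | inj₁ (n , refl) with <-cmp d (n + suc ℓ)
    ...     | tri≈ _ refl _ = inj₁ (inj₂ (inj₁ (n , refl , sym (b≡a+ n))))
    ...     | tri> _ _ n+ℓ<d = inj₂ (a n , b n , move-y (subst (_< a n + d) (sym (b≡a+ n)) (+-monoʳ-< (a n) n+ℓ<d)) ,
                                     inj₂ (inj₁ (n , refl , refl)))
    ...     | tri< d<n+ℓ _ _ with m≤n⇒∃[o]m+o≡n (≰⇒> d≰ℓ)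
    ...       | m , refl = inj₂ (a m , b m , move-diag (a-mono-< m<n) (shuffle (a m) (a n) m (suc ℓ)) ,
                                 inj₂ (inj₁ (m , refl , refl)))
      where
      m<n : m < n
      m<n = +-cancelʳ-< (suc ℓ) m n (subst (_< n + suc ℓ) (+-comm (suc ℓ) m) d<n+ℓ)
      shuffle : ∀ p q m s → p + (q + (s + m)) ≡ p + m + s + q
      shuffle = solve-∀

    absorbing : ∀ {x y} → ℓ < x + y → Absorbed x y
    absorbing {x} {y} ℓ<x+y with x ≤? y
    ... | yes x≤y = absorbing-≤ x≤y ℓ<x+y
    ... | no x≰y with absorbing-≤ (<⇒≤ (≰⇒> x≰y)) (subst (ℓ <_) (+-comm x y) ℓ<x+y)
    ...   | inj₁ yx∈𝒫 = inj₁ (𝒫-swap yx∈𝒫)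
    ...   | inj₂ (y' , x' , mv , ∈𝒫) = inj₂ (x' , y' , move-swap mv , 𝒫-swap ∈𝒫)

    IsP⇔𝒫 : ∀ x y → IsP ℓ x y ⇔ 𝒫 x y
    IsP⇔𝒫 = Kernel.IsP⇔S ℓ 𝒫 inj₁ 𝒫-independent absorbing

    IsP⇔pair : ∀ x y → x ≤ y → IsP ℓ x y ⇔ (x + y ≤ ℓ ⊎ ∃[ n ] x ≡ a n × y ≡ b n)
    IsP⇔pair x y x≤y = mk⇔ (unswap ∘ to) (from ∘ map₂ inj₁)
      where
      open Equivalence (IsP⇔𝒫 x y)
      unswap : 𝒫 x y → x + y ≤ ℓ ⊎ ∃[ n ] x ≡ a n × y ≡ b n
      unswap (inj₁ x+y≤ℓ) = inj₁ x+y≤ℓ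
      unswap (inj₂ (inj₁ pair)) = inj₂ pair
      unswap (inj₂ (inj₂ (n , refl , refl))) = ⊥-elim (<⇒≱ (a<b n) x≤y)

  -- b n lies strictly between the consecutive values a (a n − 1) and a (a n), so it is not a value of a;
  -- gap-hit makes every gap of size 2 of this form.
  module Local (a₀ : a 0 ≡ suc ℓ)
    (b-below : ∀ n → a (pred (a n)) < b n)
    (b-above : ∀ n → b n < a (a n))
    (gap≤2 : ∀ j → a (suc j) ≤ a j + 2)
    (gap-hit : ∀ j → a (suc j) ≡ a j + 2 → ∃[ n ] a n ≡ suc j) where

    a≢b : ∀ m n → a m ≢ b n
    a≢b m n am≡bn = <⇒≱ (a-cancel-< (subst (a (pred (a n)) <_) (sym am≡bn) (b-below n)))
                        (<⇒≤pred (a-cancel-< (subst (_< a (a n)) (sym am≡bn) (b-above n))))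

    gap-value : ∀ {j N} → a j < N → N < a (suc j) → N ≡ suc (a j) × a (suc j) ≡ a j + 2
    gap-value {j} {N} aj<N N<aj+1 =
      N≡ , ≤-antisym (gap≤2 j) (subst (_≤ a (suc j)) (trans (cong suc N≡) (+-comm 2 (a j))) N<aj+1)
      where
      N≡ : N ≡ suc (a j)
      N≡ = m<n<m+2⇒n≡1+m aj<N (<-≤-trans N<aj+1 (gap≤2 j))

    gap-in-b : ∀ {j N} → a j < N → N < a (suc j) → ∃[ n ] b n ≡ N
    gap-in-b {j} aj<N N<aj+1 with gap-value aj<N N<aj+1
    ... | N≡ , gap with gap-hit j gap
    ...   | n , an≡1+j = n , trans (m<n<m+2⇒n≡1+m below above) (sym N≡)
      where
      below : a j < b n
      below = subst (λ i → a (pred i) < b n) an≡1+j (b-below n)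
      above : b n < a j + 2
      above = subst (b n <_) (trans (cong a an≡1+j) gap) (b-above n)

    cover : ∀ N → ℓ < N → (∃[ n ] a n ≡ N) ⊎ (∃[ n ] b n ≡ N)
    cover N ℓ<N with bracket a a-mono N (subst (_≤ N) (sym a₀) ℓ<N)
    ... | j , aj≤N , N<aj+1 with m≤n⇒m<n∨m≡n aj≤N
    ...   | inj₂ aj≡N = inj₁ (j , aj≡N)
    ...   | inj₁ aj<N = inj₂ (gap-in-b aj<N N<aj+1)

-- Floors of multiples of φ

isqrt-spec : ∀ m → isqrt m * isqrt m ≤ m × m < suc (isqrt m) * suc (isqrt m)
isqrt-spec zero = z≤n , s≤s z≤n
isqrt-spec (suc m) with isqrt m | isqrt-spec m
... | r | r²≤m , m<[1+r]² with suc r * suc r ≤ᵇ suc m in eq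
...   | true = ≤ᵇ⇒≤ (suc r * suc r) (suc m) (subst T (sym eq) tt) ,
               ≤-trans (s≤s m<[1+r]²) (*-mono-< (n<1+n (suc r)) (n<1+n (suc r)))
...   | false = m≤n⇒m≤1+n r²≤m , 1+m<[1+r]²
  where
  1+m<[1+r]² : suc m < suc r * suc r
  1+m<[1+r]² with suc m <? suc r * suc r
  ... | yes lt = lt
  ... | no ≮ = ⊥-elim (subst T eq (≤⇒≤ᵇ (≮⇒≥ ≮)))

square-cancel-< : ∀ {m n} → m * m < n * n → m < n
square-cancel-< {m} {n} m²<n² with m <? n
... | yes m<n = m<n
... | no m≮n = ⊥-elim (<⇒≱ m²<n² (*-mono-≤ (≮⇒≥ m≮n) (≮⇒≥ m≮n)))

square-cancel-≤ : ∀ {m n} → m * m ≤ n * n → m ≤ n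
square-cancel-≤ {m} {n} m²≤n² with m ≤? n
... | yes m≤n = m≤n
... | no m≰n = ⊥-elim (<⇒≱ (*-mono-< (≰⇒> m≰n) (≰⇒> m≰n)) m²≤n²)

5∣²⇒5∣ : ∀ s → 5 ∣ s * s → ∃[ t ] s ≡ t * 5
5∣²⇒5∣ s 5∣s² with euclidsLemma s s (toWitness {a? = prime? 5} tt) 5∣s²
... | inj₁ (divides t s≡t*5) = t , s≡t*5
... | inj₂ (divides t s≡t*5) = t , s≡t*5

√5-irrational : ∀ s n → s * s ≡ 5 * (n * n) → n ≡ 0
√5-irrational s n = <-rec (λ n → ∀ s → s * s ≡ 5 * (n * n) → n ≡ 0) descent n s
  where
  descent : ∀ n → (∀ {m} → m < n → ∀ s → s * s ≡ 5 * (m * m) → m ≡ 0) →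
            ∀ s → s * s ≡ 5 * (n * n) → n ≡ 0
  descent n IH s s²≡5n² with 5∣²⇒5∣ s (divides (n * n) (trans s²≡5n² (*-comm 5 (n * n))))
  ... | t , refl with 5∣²⇒5∣ n (divides (t * t) (*-cancelˡ-≡ (n * n) (t * t * 5) 5 (trans (sym s²≡5n²) (reassoc t))))
    where
    reassoc : ∀ t → t * 5 * (t * 5) ≡ 5 * (t * t * 5)
    reassoc = solve-∀
  ...   | zero , refl = refl
  ...   | u@(suc _) , refl = ⊥-elim (1+n≢0 (IH (m<m*n u 5 (s≤s (s≤s z≤n))) t t²≡5u²))
    where
    t²≡5u² : t * t ≡ 5 * (u * u)
    t²≡5u² = *-cancelˡ-≡ (t * t) (5 * (u * u)) 25 (trans (square-*5 t) (trans s²≡5n² (5*square-*5 u)))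
      where
      square-*5 : ∀ t → 25 * (t * t) ≡ t * 5 * (t * 5)
      square-*5 = solve-∀
      5*square-*5 : ∀ u → 5 * (u * 5 * (u * 5)) ≡ 25 * (5 * (u * u))
      5*square-*5 = solve-∀

infix 4 _<√5·_ √5·_<_

_<√5·_ : ℕ → ℕ → Set
d <√5· n = d * d < 5 * (n * n)

√5·_<_ : ℕ → ℕ → Set
√5· n < d = 5 * (n * n) < d * d

[r+q*2]/2≡q : ∀ q {r} → r < 2 → (r + q * 2) / 2 ≡ q
[r+q*2]/2≡q q {r} r<2 = trans (+-distrib-/-∣ʳ r (divides q refl)) (cong₂ _+_ (m<n⇒m/n≡0 r<2) (m*n/n≡m q 2))

floorPhi-unique : ∀ {n q d} → d + n ≡ q + q → d <√5· n → √5· n < 2 + d → floorPhi n ≡ q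
floorPhi-unique {n} {q} {d} d+n≡2q d<√5n √5n<2+d with m≤n⇒∃[o]m+o≡n d≤s
  where
  s : ℕ
  s = isqrt (5 * (n * n))
  d≤s : d ≤ s
  d≤s = ≤-pred (square-cancel-< (<-trans d<√5n (proj₂ (isqrt-spec _))))
... | e , d+e≡s = begin
  (n + isqrt (5 * (n * n))) / 2 ≡⟨ cong (λ s → (n + s) / 2) (sym d+e≡s) ⟩
  (n + (d + e)) / 2             ≡⟨ cong (_/ 2) (trans (shuffle n d e) (cong (e +_) (trans d+n≡2q (+-*2 q)))) ⟩
  (e + q * 2) / 2               ≡⟨ [r+q*2]/2≡q q e<2 ⟩
  q                             ∎
  where
  open ≡-Reasoning
  shuffle : ∀ n d e → n + (d + e) ≡ e + (d + n)
  shuffle = solve-∀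
  +-*2 : ∀ q → q + q ≡ q * 2
  +-*2 = solve-∀
  e<2 : e < 2
  e<2 = +-cancelˡ-< d e 2 (subst₂ _<_ (sym d+e≡s) (+-comm 2 d) s<2+d)
    where
    s<2+d : isqrt (5 * (n * n)) < 2 + d
    s<2+d = square-cancel-< (≤-<-trans (proj₁ (isqrt-spec (5 * (n * n)))) √5n<2+d)

-- x = 2⌊mφ⌋ − m is the largest integer below m√5 with the parity of m.
record FloorPhiBounds (m : ℕ) : Set where
  field
    x : ℕ
    x+m≡2a : x + m ≡ floorPhi m + floorPhi m
    x<√5·m : x <√5· m
    √5·m<2+x : √5· m < 2 + x

floorPhi-bounds : ∀ m .{{_ : NonZero m}} → FloorPhiBounds m
floorPhi-bounds m = record { x = s ∸ e ; x+m≡2a = x+m≡2a ; x<√5·m = x<√5m ; √5·m<2+x = √5m<2+x }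
  where
  s : ℕ
  s = isqrt (5 * (m * m))
  a : ℕ
  a = floorPhi m
  e : ℕ
  e = (m + s) % 2
  e<2 : e < 2
  e<2 = m%n<n (m + s) 2
  m≤s : m ≤ s
  m≤s = ≤-pred (square-cancel-< (≤-<-trans (m≤m+n (m * m) (4 * (m * m))) (proj₂ (isqrt-spec _))))
  e≤s : e ≤ s
  e≤s = ≤-trans (≤-pred e<2) (≤-trans (n≢0⇒n>0 (≢-nonZero⁻¹ m)) m≤s)
  x+m≡2a : s ∸ e + m ≡ a + a
  x+m≡2a = +-cancelˡ-≡ e _ _ (begin
    e + (s ∸ e + m)   ≡⟨ shuffle e (s ∸ e) m ⟩
    m + (s ∸ e + e)   ≡⟨ cong (m +_) (m∸n+n≡m e≤s) ⟩
    m + s             ≡⟨ m≡m%n+[m/n]*n (m + s) 2 ⟩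
    e + a * 2         ≡⟨ cong (e +_) (*2 a) ⟩
    e + (a + a)       ∎)
    where
    open ≡-Reasoning
    shuffle : ∀ e x m → e + (x + m) ≡ m + (x + e)
    shuffle = solve-∀
    *2 : ∀ a → a * 2 ≡ a + a
    *2 = solve-∀
  x<√5m : s ∸ e <√5· m
  x<√5m = ≤∧≢⇒< (≤-trans (*-mono-≤ (m∸n≤m s e) (m∸n≤m s e)) (proj₁ (isqrt-spec _)))
                λ x²≡5m² → ≢-nonZero⁻¹ m (√5-irrational (s ∸ e) m x²≡5m²)
  √5m<2+x : √5· m < 2 + (s ∸ e)
  √5m<2+x = <-≤-trans (proj₂ (isqrt-spec _)) (*-mono-≤ 1+s≤2+x 1+s≤2+x)
    where
    1+s≤2+x : suc s ≤ 2 + (s ∸ e)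
    1+s≤2+x = s≤s (subst₂ _≤_ (m∸n+n≡m e≤s) (+-comm (s ∸ e) 1) (+-monoʳ-≤ (s ∸ e) (≤-pred e<2)))

private
  square-suc : ∀ x → suc x * suc x ≡ x * x + (x + x + 1)
  square-suc = solve-∀

  5*square-suc : ∀ m → 5 * (suc m * suc m) ≡ 5 * (m * m) + (5 * m + 5 * m + 5)
  5*square-suc = solve-∀

  increment-bound : ∀ {x m} → x * x ≤ 5 * (m * m) → x + x + 1 ≤ 5 * m + 5 * m + 5
  increment-bound {x} {m} x²≤5m² = +-mono-≤ (+-mono-≤ x≤5m x≤5m) (s≤s z≤n)
    where
    x≤5m : x ≤ 5 * m
    x≤5m = square-cancel-≤ (≤-trans x²≤5m² (≤-trans (*-monoˡ-≤ (m * m) (m≤m+n 5 20)) (≤-reflexive (25m² m))))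
      where
      25m² : ∀ m → 25 * (m * m) ≡ 5 * m * (5 * m)
      25m² = solve-∀

<√5·-suc : ∀ {x m} → x <√5· m → suc x <√5· suc m
<√5·-suc {x} {m} x<√5m = subst₂ _<_ (sym (square-suc x)) (sym (5*square-suc m))
  (+-mono-<-≤ x<√5m (increment-bound {x} {m} (<⇒≤ x<√5m)))

√5·<-pred : ∀ {m x} → √5· suc m < suc x → √5· m < x
√5·<-pred {m} {x} √5[1+m]<1+x = ≰⇒> λ x²≤5m² → <⇒≱ √5[1+m]<1+x
  (subst₂ _≤_ (sym (square-suc x)) (sym (5*square-suc m)) (+-mono-≤ x²≤5m² (increment-bound {x} {m} x²≤5m²)))

norm-identity : ∀ {n t v} → t + v ≡ n + n → (n + v + v) * (n + v + v) + t * t ≡ 5 * (n * n) + 5 * (v * v)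
norm-identity {n} {t} {v} t+v≡2n = *-cancelˡ-≡ _ _ 4 (begin
  4 * ((n + v + v) * (n + v + v) + t * t)            ≡⟨ double n v t ⟩
  (n + n + 4 * v) * (n + n + 4 * v) + 4 * (t * t)    ≡⟨ cong (λ z → (z + 4 * v) * (z + 4 * v) + 4 * (t * t)) (sym t+v≡2n) ⟩
  (t + v + 4 * v) * (t + v + 4 * v) + 4 * (t * t)    ≡⟨ conjugate t v ⟩
  5 * ((t + v) * (t + v)) + 20 * (v * v)             ≡⟨ cong (λ z → 5 * (z * z) + 20 * (v * v)) t+v≡2n ⟩
  5 * ((n + n) * (n + n)) + 20 * (v * v)             ≡⟨ undouble n v ⟩
  4 * (5 * (n * n) + 5 * (v * v))                    ∎)
  where
  open ≡-Reasoning
  double : ∀ n v t → 4 * ((n + v + v) * (n + v + v) + t * t) ≡ (n + n + 4 * v) * (n + n + 4 * v) + 4 * (t * t)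
  double = solve-∀
  conjugate : ∀ t v → (t + v + 4 * v) * (t + v + 4 * v) + 4 * (t * t) ≡ 5 * ((t + v) * (t + v)) + 20 * (v * v)
  conjugate = solve-∀
  undouble : ∀ n v → 5 * ((n + n) * (n + n)) + 20 * (v * v) ≡ 4 * (5 * (n * n) + 5 * (v * v))
  undouble = solve-∀

balance-< : ∀ {p q u v} → u < v → p + v ≡ q + u → p < q
balance-< {p} {q} {u} {v} u<v p+v≡q+u = +-cancelʳ-< v p q (subst (_< q + v) (sym p+v≡q+u) (+-monoʳ-< q u<v))

-- ⌊nφ⌋ = n + ⌊n/φ⌋, and ⌊n/φ⌋ = v iff v√5 < 2n − v < (v + 1)√5 + 1; here t = 2n − v − 1.
floorPhi-char : ∀ {n v t} → suc t + v ≡ n + n → √5· v < suc t → t <√5· suc v → floorPhi n ≡ n + v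
floorPhi-char {n} {v} {t} 1+t+v≡2n √5v<1+t t<√5[1+v] = floorPhi-unique (d+n n v) lower upper
  where
  d+n : ∀ n v → n + v + v + n ≡ n + v + (n + v)
  d+n = solve-∀
  lower : n + v + v <√5· n
  lower = balance-< √5v<1+t (norm-identity {n} {suc t} {v} 1+t+v≡2n)
  upper : √5· n < 2 + (n + v + v)
  upper = balance-< t<√5[1+v] (sym (trans (cong (λ d → d * d + t * t) (d+2 n v))
                                          (norm-identity {n} {t} {suc v} (trans (+-suc t v) 1+t+v≡2n))))
    where
    d+2 : ∀ n v → 2 + (n + v + v) ≡ n + suc v + suc v
    d+2 = solve-∀

floorPhi-floorPhi : ∀ m → floorPhi (floorPhi (suc m)) ≡ floorPhi (suc m) + m
floorPhi-floorPhi m = floorPhi-char {floorPhi (suc m)} {m} {x}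
  (trans (sym (+-suc x m)) x+m≡2a) (√5·<-pred {m} {suc x} √5·m<2+x) x<√5·m
  where open FloorPhiBounds (floorPhi-bounds (suc m))

floorPhi-1+floorPhi : ∀ m → floorPhi (1 + floorPhi (suc m)) ≡ (1 + floorPhi (suc m)) + suc m
floorPhi-1+floorPhi m = floorPhi-char {1 + a} {suc m} {suc x}
  (trans (cong (2 +_) x+m≡2a) (sym (+-suc (suc a) a))) √5·m<2+x (<√5·-suc {x} {suc m} x<√5·m)
  where
  a : ℕ
  a = floorPhi (suc m)
  open FloorPhiBounds (floorPhi-bounds (suc m))

floorPhi-2+floorPhi : ∀ m → floorPhi (2 + m) ≡ floorPhi (suc m) + 2 →
                      floorPhi (2 + floorPhi (suc m)) ≡ (2 + floorPhi (suc m)) + suc m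
floorPhi-2+floorPhi m next≡a+2 = floorPhi-char {2 + a} {suc m} {3 + x}
  (trans (cong (4 +_) x+m≡2a) (4+2a a)) (<-≤-trans √5·m<2+x (*-mono-≤ 2+x≤4+x 2+x≤4+x))
  (subst (_<√5· 2 + m) x'≡3+x Next.x<√5·m)
  where
  a : ℕ
  a = floorPhi (suc m)
  open FloorPhiBounds (floorPhi-bounds (suc m))
  module Next = FloorPhiBounds (floorPhi-bounds (2 + m))
  4+2a : ∀ a → 4 + (a + a) ≡ 2 + a + (2 + a)
  4+2a = solve-∀
  2+x≤4+x : 2 + x ≤ 4 + x
  2+x≤4+x = m≤n+m (2 + x) 2
  x'≡3+x : Next.x ≡ 3 + x
  x'≡3+x = +-cancelʳ-≡ (2 + m) Next.x (3 + x) (begin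
    Next.x + (2 + m)                    ≡⟨ Next.x+m≡2a ⟩
    floorPhi (2 + m) + floorPhi (2 + m) ≡⟨ cong (λ z → z + z) next≡a+2 ⟩
    a + 2 + (a + 2)                     ≡⟨ a+2+[a+2] a ⟩
    4 + (a + a)                         ≡⟨ cong (4 +_) (sym x+m≡2a) ⟩
    4 + (x + suc m)                     ≡⟨ 4+[x+m] x m ⟩
    3 + x + (2 + m)                     ∎)
    where
    open ≡-Reasoning
    a+2+[a+2] : ∀ a → a + 2 + (a + 2) ≡ 4 + (a + a)
    a+2+[a+2] = solve-∀
    4+[x+m] : ∀ x m → 4 + (x + suc m) ≡ 3 + x + (2 + m)
    4+[x+m] = solve-∀

floorPhi2≡floorPhi+ : ∀ n → floorPhi2 n ≡ floorPhi n + n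
floorPhi2≡floorPhi+ n = trans (cong (_/ 2) (3n+s n s))
  (trans (+-distrib-/-∣ʳ (n + s) (divides n refl)) (cong ((n + s) / 2 +_) (m*n/n≡m n 2)))
  where
  s : ℕ
  s = isqrt (5 * (n * n))
  3n+s : ∀ n s → 3 * n + s ≡ n + s + n * 2
  3n+s = solve-∀

-- The fixed point of μ₄

letters : Vec Letter 18
letters = l0 ∷ᵛ l1 ∷ᵛ l2 ∷ᵛ l3 ∷ᵛ l4 ∷ᵛ l5 ∷ᵛ l6 ∷ᵛ l7 ∷ᵛ l8 ∷ᵛ l9 ∷ᵛ
          la ∷ᵛ lb ∷ᵛ lc ∷ᵛ ld ∷ᵛ le ∷ᵛ lf ∷ᵛ lg ∷ᵛ lh ∷ᵛ []ᵛ

index : Letter → Fin 18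
index l0 = # 0
index l1 = # 1
index l2 = # 2
index l3 = # 3
index l4 = # 4
index l5 = # 5
index l6 = # 6
index l7 = # 7
index l8 = # 8
index l9 = # 9
index la = # 10
index lb = # 11
index lc = # 12
index ld = # 13
index le = # 14
index lf = # 15
index lg = # 16
index lh = # 17

lookup-index : ∀ x → lookup letters (index x) ≡ x
lookup-index l0 = refl
lookup-index l1 = refl
lookup-index l2 = refl
lookup-index l3 = refl
lookup-index l4 = refl
lookup-index l5 = refl
lookup-index l6 = refl
lookup-index l7 = refl
lookup-index l8 = refl
lookup-index l9 = refl
lookup-index la = refl
lookup-index lb = refl
lookup-index lc = refl
lookup-index ld = refl
lookup-index le = refl
lookup-index lf = refl
lookup-index lg = refl
lookup-index lh = refl

∀-letter : ∀ {P : Letter → Set} (P? : Decidable P) → {True (Fin.all? (P? ∘ lookup letters))} → ∀ x → P x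
∀-letter {P} P? {all} x = subst P (lookup-index x) (toWitness all (index x))

_≟ᴸ_ : DecidableEquality Letter
x ≟ᴸ y = map′ index-injective (cong index) (index x Fin.≟ index y)
  where
  index-injective : index x ≡ index y → x ≡ y
  index-injective eq = trans (sym (lookup-index x)) (trans (cong (lookup letters) eq) (lookup-index y))

len : Letter → ℕ
len x = length (μ₄ x)

1≤len : ∀ x → 1 ≤ len x
1≤len = ∀-letter (λ x → 1 ≤? len x)

len≤2 : ∀ x → len x ≤ 2
len≤2 = ∀-letter (λ x → len x ≤? 2)

w : ℕ → Letter
w = fixpt

iterate : ℕ → List Letter
iterate k = iter k (l0 ∷ [])

length-μ₄* : ∀ xs → length xs ≤ length (μ₄* xs)
length-μ₄* [] = z≤n
length-μ₄* (x ∷ xs) = subst (suc (length xs) ≤_) (sym (List.length-++ (μ₄ x))) (+-mono-≤ (1≤len x) (length-μ₄* xs))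

iterate-head : ∀ k → ∃[ t ] iterate k ≡ l0 ∷ t
iterate-head zero = [] , refl
iterate-head (suc k) with t , eq ← iterate-head k = l1 ∷ μ₄* t , cong μ₄* eq

length-iterate : ∀ k → k < length (iterate k)
length-iterate zero = s≤s z≤n
length-iterate (suc k) with t , eq ← iterate-head k =
  ≤-trans (s≤s (length-iterate k))
          (subst (λ u → suc (length u) ≤ length (μ₄* u)) (sym eq) (s≤s (s≤s (length-μ₄* t))))

iterate-extends : ∀ k → ∃[ r ] iterate (suc k) ≡ iterate k ++ r
iterate-extends zero = l1 ∷ [] , refl
iterate-extends (suc k) with r , eq ← iterate-extends k = μ₄* r , trans (cong μ₄* eq) (List.concatMap-++ μ₄ (iterate k) r)

iterate-prefix : ∀ k n → ∃[ r ] iterate (k + n) ≡ iterate k ++ r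
iterate-prefix k zero = [] , trans (cong iterate (+-identityʳ k)) (sym (List.++-identityʳ (iterate k)))
iterate-prefix k (suc n) with r , eq ← iterate-prefix k n | r' , eq' ← iterate-extends (k + n) =
  r ++ r' , (begin
    iterate (k + suc n)        ≡⟨ cong iterate (+-suc k n) ⟩
    iterate (suc (k + n))      ≡⟨ eq' ⟩
    iterate (k + n) ++ r'      ≡⟨ cong (_++ r') eq ⟩
    (iterate k ++ r) ++ r'     ≡⟨ List.++-assoc (iterate k) r r' ⟩
    iterate k ++ (r ++ r')     ∎)
  where open ≡-Reasoning

nth-++ˡ : ∀ {n} xs ys → n < length xs → nth n (xs ++ ys) ≡ nth n xs
nth-++ˡ {zero} (x ∷ xs) ys _ = refl
nth-++ˡ {suc n} (x ∷ xs) ys n<len = nth-++ˡ xs ys (≤-pred n<len)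

nth-++ʳ : ∀ n xs ys → nth (length xs + n) (xs ++ ys) ≡ nth n ys
nth-++ʳ n [] ys = refl
nth-++ʳ n (x ∷ xs) ys = nth-++ʳ n xs ys

nth-iterate : ∀ {n} k → n < length (iterate k) → nth n (iterate k) ≡ w n
nth-iterate {n} k n<len with r , eq ← iterate-prefix k (suc n) | r' , eq' ← iterate-prefix (suc n) k = begin
  nth n (iterate k)                ≡⟨ sym (nth-++ˡ (iterate k) r n<len) ⟩
  nth n (iterate k ++ r)           ≡⟨ cong (nth n) (sym eq) ⟩
  nth n (iterate (k + suc n))      ≡⟨ cong (λ i → nth n (iterate i)) (+-comm k (suc n)) ⟩
  nth n (iterate (suc n + k))      ≡⟨ cong (nth n) eq' ⟩
  nth n (iterate (suc n) ++ r')    ≡⟨ nth-++ˡ (iterate (suc n)) r' (<⇒≤ (length-iterate (suc n))) ⟩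
  nth n (iterate (suc n))          ∎
  where open ≡-Reasoning

-- pos k is the position in w at which the block μ₄ (w k) starts.
pos : ℕ → ℕ
pos zero = 0
pos (suc k) = pos k + len (w k)

factor : ℕ → ℕ → List Letter
factor i zero = []
factor i (suc n) = w i ∷ factor (suc i) n

length-factor : ∀ i n → length (factor i n) ≡ n
length-factor i zero = refl
length-factor i (suc n) = cong suc (length-factor (suc i) n)

nth-factor : ∀ {i n} j → i < n → nth i (factor j n) ≡ w (j + i)
nth-factor {zero} {suc n} j _ = cong w (sym (+-identityʳ j))
nth-factor {suc i} {suc n} j i<n = trans (nth-factor (suc j) (≤-pred i<n)) (cong w (sym (+-suc j i)))

take-factor : ∀ {m n} j → m ≤ n → take m (factor j n) ≡ factor j m
take-factor {zero} j _ = refl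
take-factor {suc m} {suc n} j m≤n = cong (w j ∷_) (take-factor (suc j) (≤-pred m≤n))

drop-factor : ∀ {t n} j → t ≤ n → drop t (factor j n) ≡ factor (j + t) (n ∸ t)
drop-factor {zero} {n} j _ = cong (λ i → factor i n) (sym (+-identityʳ j))
drop-factor {suc t} {suc n} j t≤n =
  trans (drop-factor (suc j) (≤-pred t≤n)) (cong (λ i → factor i (n ∸ t)) (sym (+-suc j t)))

factor-++ : ∀ j n m → factor j (n + m) ≡ factor j n ++ factor (j + n) m
factor-++ j zero m = cong (λ i → factor i m) (sym (+-identityʳ j))
factor-++ j (suc n) m =
  cong (w j ∷_) (trans (factor-++ (suc j) n m) (cong (λ i → factor (suc j) n ++ factor i m) (sym (+-suc j n))))

take-agreeing : ∀ {k} j xs → (∀ {i} → i < length xs → nth i xs ≡ w (j + i)) →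
                k ≤ length xs → take k xs ≡ factor j k
take-agreeing {zero} j xs _ _ = refl
take-agreeing {suc k} j (x ∷ xs) agree k≤len = cong₂ _∷_ (trans (agree (s≤s z≤n)) (cong w (+-identityʳ j)))
  (take-agreeing (suc j) xs (λ i<len → trans (agree (s≤s i<len)) (cong w (+-suc j _))) (≤-pred k≤len))

factor-agreeing : ∀ j ys → (∀ {i} → i < length ys → nth i ys ≡ w (j + i)) → factor j (length ys) ≡ ys
factor-agreeing j ys agree = trans (sym (take-agreeing j ys agree ≤-refl)) (List.take-all (length ys) ys ≤-refl)

take-iterate : ∀ {k} K → k ≤ length (iterate K) → take k (iterate K) ≡ factor 0 k
take-iterate K = take-agreeing 0 (iterate K) (nth-iterate K)

pos-+ : ∀ j n → pos (j + n) ≡ pos j + length (μ₄* (factor j n))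
pos-+ j zero = trans (cong pos (+-identityʳ j)) (sym (+-identityʳ (pos j)))
pos-+ j (suc n) = begin
  pos (j + suc n)                                   ≡⟨ cong pos (+-suc j n) ⟩
  pos (suc j + n)                                   ≡⟨ pos-+ (suc j) n ⟩
  pos j + len (w j) + length (μ₄* (factor (suc j) n)) ≡⟨ +-assoc (pos j) _ _ ⟩
  pos j + (len (w j) + length (μ₄* (factor (suc j) n))) ≡⟨ cong (pos j +_) (sym (List.length-++ (μ₄ (w j)))) ⟩
  pos j + length (μ₄* (factor j (suc n)))           ∎
  where open ≡-Reasoning

nth-μ₄* : ∀ {k i} xs → k < length xs → i < len (nth k xs) →
          nth (length (μ₄* (take k xs)) + i) (μ₄* xs) ≡ nth i (μ₄ (nth k xs))
nth-μ₄* {zero} {i} (x ∷ xs) _ i<len = nth-++ˡ (μ₄ x) (μ₄* xs) i<len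
nth-μ₄* {suc k} {i} (x ∷ xs) k<len i<len = begin
  nth (length (μ₄ x ++ μ₄* (take k xs)) + i) (μ₄ x ++ μ₄* xs)
    ≡⟨ cong (λ p → nth p (μ₄ x ++ μ₄* xs)) index≡ ⟩
  nth (len x + (length (μ₄* (take k xs)) + i)) (μ₄ x ++ μ₄* xs)  ≡⟨ nth-++ʳ _ (μ₄ x) (μ₄* xs) ⟩
  nth (length (μ₄* (take k xs)) + i) (μ₄* xs)                    ≡⟨ nth-μ₄* xs (≤-pred k<len) i<len ⟩
  nth i (μ₄ (nth k xs))                                          ∎
  where
  open ≡-Reasoning
  index≡ : length (μ₄ x ++ μ₄* (take k xs)) + i ≡ len x + (length (μ₄* (take k xs)) + i)
  index≡ = trans (cong (_+ i) (List.length-++ (μ₄ x))) (+-assoc (len x) _ i)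

w-pos : ∀ k {i} → i < len (w k) → w (pos k + i) ≡ nth i (μ₄ (w k))
w-pos k {i} i<len = begin
  w (pos k + i)                                                  ≡⟨ sym (nth-iterate (suc K) in-range) ⟩
  nth (pos k + i) (μ₄* (iterate K))
    ≡⟨ cong (λ p → nth (p + i) (μ₄* (iterate K))) (sym pos≡) ⟩
  nth (length (μ₄* (take k (iterate K))) + i) (μ₄* (iterate K))
    ≡⟨ nth-μ₄* (iterate K) k<len (subst (λ x → i < len x) (sym wk≡) i<len) ⟩
  nth i (μ₄ (nth k (iterate K)))                                 ≡⟨ cong (λ x → nth i (μ₄ x)) wk≡ ⟩
  nth i (μ₄ (w k))                                               ∎
  where
  open ≡-Reasoning
  K : ℕ
  K = pos k + i + k
  k<len : k < length (iterate K)
  k<len = ≤-<-trans (m≤n+m k (pos k + i)) (length-iterate K)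
  wk≡ : nth k (iterate K) ≡ w k
  wk≡ = nth-iterate K k<len
  pos≡ : length (μ₄* (take k (iterate K))) ≡ pos k
  pos≡ = trans (cong (λ u → length (μ₄* u)) (take-iterate K (<⇒≤ k<len))) (sym (pos-+ 0 k))
  in-range : pos k + i < length (iterate (suc K))
  in-range = ≤-<-trans (≤-trans (m≤m+n (pos k + i) k) (n≤1+n K)) (length-iterate (suc K))

μ₄*-factor : ∀ k n → μ₄* (factor k n) ≡ factor (pos k) (length (μ₄* (factor k n)))
μ₄*-factor k zero = refl
μ₄*-factor k (suc n) = sym (begin
  factor (pos k) (length (μ₄ (w k) ++ μ₄* (factor (suc k) n)))
    ≡⟨ cong (factor (pos k)) (List.length-++ (μ₄ (w k))) ⟩
  factor (pos k) (len (w k) + length (μ₄* (factor (suc k) n)))         ≡⟨ factor-++ (pos k) (len (w k)) _ ⟩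
  factor (pos k) (len (w k)) ++ factor (pos (suc k)) (length (μ₄* (factor (suc k) n)))
    ≡⟨ cong₂ _++_ (factor-agreeing (pos k) (μ₄ (w k)) (λ i<len → sym (w-pos k i<len))) (sym (μ₄*-factor (suc k) n)) ⟩
  μ₄ (w k) ++ μ₄* (factor (suc k) n)                                   ∎)
  where open ≡-Reasoning

length-μ₄*² : ∀ xs → length (μ₄* (μ₄* xs)) ≡ length (μ₄* xs) + length xs
length-μ₄*² [] = refl
length-μ₄*² (x ∷ xs) = begin
  length (μ₄* (μ₄ x ++ μ₄* xs))
    ≡⟨ cong length (List.concatMap-++ μ₄ (μ₄ x) (μ₄* xs)) ⟩
  length (μ₄* (μ₄ x) ++ μ₄* (μ₄* xs))                       ≡⟨ List.length-++ (μ₄* (μ₄ x)) ⟩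
  length (μ₄* (μ₄ x)) + length (μ₄* (μ₄* xs))               ≡⟨ cong₂ _+_ (len-μ₄ x) (length-μ₄*² xs) ⟩
  len x + 1 + (length (μ₄* xs) + length xs)                 ≡⟨ regroup (len x) (length (μ₄* xs)) (length xs) ⟩
  len x + length (μ₄* xs) + suc (length xs)                 ≡⟨ cong (_+ suc (length xs)) (sym (List.length-++ (μ₄ x))) ⟩
  length (μ₄ x ++ μ₄* xs) + suc (length xs)                 ∎
  where
  open ≡-Reasoning
  len-μ₄ : ∀ x → length (μ₄* (μ₄ x)) ≡ len x + 1
  len-μ₄ = ∀-letter (λ x → length (μ₄* (μ₄ x)) ≟ len x + 1)
  regroup : ∀ l m n → l + 1 + (m + n) ≡ l + m + suc n
  regroup = solve-∀

pos-pos : ∀ k → pos (pos k) ≡ pos k + k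
pos-pos k = begin
  pos (pos k)                                  ≡⟨ pos-+ 0 (pos k) ⟩
  length (μ₄* (factor 0 (pos k)))              ≡⟨ cong (λ n → length (μ₄* (factor 0 n))) (pos-+ 0 k) ⟩
  length (μ₄* (factor 0 (length (μ₄* (factor 0 k))))) ≡⟨ cong (λ u → length (μ₄* u)) (sym (μ₄*-factor 0 k)) ⟩
  length (μ₄* (μ₄* (factor 0 k)))              ≡⟨ length-μ₄*² (factor 0 k) ⟩
  length (μ₄* (factor 0 k)) + length (factor 0 k) ≡⟨ cong₂ _+_ (sym (pos-+ 0 k)) (length-factor 0 k) ⟩
  pos k + k                                    ∎
  where open ≡-Reasoning

pos-mono : ∀ k → pos k < pos (suc k)
pos-mono k = subst (_≤ pos k + len (w k)) (+-comm (pos k) 1) (+-monoʳ-≤ (pos k) (1≤len (w k)))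

InBlock : ℕ → Set
InBlock j = ∃₂ λ k t → pos k + t ≡ j × t < len (w k)

block-of : ∀ j → InBlock j
block-of j with k , posk≤j , j<posk+1 ← bracket pos pos-mono j z≤n =
  k , j ∸ pos k , m+[n∸m]≡n posk≤j , +-cancelˡ-< (pos k) _ _ (subst (_< pos (suc k)) (sym (m+[n∸m]≡n posk≤j)) j<posk+1)

<pos : ∀ k → suc k < pos (suc k)
<pos zero = s≤s (s≤s z≤n)
<pos (suc k) = <-≤-trans (s≤s (<pos k)) (pos-mono (suc k))

≤pos : ∀ k → k ≤ pos k
≤pos zero = z≤n
≤pos (suc k) = <⇒≤ (<pos k)

LengthStep : ℕ → Set
LengthStep j = len (w j) + floorPhi (suc j) ≡ floorPhi (2 + j)

pos+1≡floorPhi-below : ∀ k → (∀ {i} → i < k → LengthStep i) → pos k + 1 ≡ floorPhi (suc k)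
pos+1≡floorPhi-below zero _ = refl
pos+1≡floorPhi-below (suc k) steps = begin
  pos k + len (w k) + 1        ≡⟨ swap (pos k) (len (w k)) ⟩
  len (w k) + (pos k + 1)      ≡⟨ cong (len (w k) +_) (pos+1≡floorPhi-below k (steps ∘ m≤n⇒m≤1+n)) ⟩
  len (w k) + floorPhi (suc k) ≡⟨ steps ≤-refl ⟩
  floorPhi (2 + k)             ∎
  where
  open ≡-Reasoning
  swap : ∀ p l → p + l + 1 ≡ l + (p + 1)
  swap = solve-∀

-- The block lengths len (w j) form the Fibonacci word over {2, 1}.
len-first : ∀ x → len (nth 0 (μ₄ x)) ≡ 2
len-first = ∀-letter (λ x → len (nth 0 (μ₄ x)) ≟ 2)

len-second : ∀ x → len x ≡ 2 → len (nth 1 (μ₄ x)) ≡ 1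
len-second = ∀-letter (λ x → (len x ≟ 2) →-dec (len (nth 1 (μ₄ x)) ≟ 1))

first-of-block : ∀ k → pos k + 1 ≡ floorPhi (suc k) → LengthStep (pos k + 0)
first-of-block k pos+1≡A = begin
  len (w (pos k + 0)) + floorPhi (suc (pos k + 0)) ≡⟨ cong₂ _+_ len≡2 (cong floorPhi 1+pos≡A) ⟩
  2 + floorPhi A                                   ≡⟨ cong (2 +_) (floorPhi-floorPhi k) ⟩
  2 + (A + k)                                      ≡⟨ cong suc (sym (+-suc A k)) ⟩
  (1 + A) + suc k                                  ≡⟨ sym (floorPhi-1+floorPhi k) ⟩
  floorPhi (1 + A)                                 ≡⟨ cong (floorPhi ∘ suc) (sym 1+pos≡A) ⟩
  floorPhi (2 + (pos k + 0))                       ∎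
  where
  open ≡-Reasoning
  A : ℕ
  A = floorPhi (suc k)
  len≡2 : len (w (pos k + 0)) ≡ 2
  len≡2 = trans (cong len (w-pos k (1≤len (w k)))) (len-first (w k))
  1+pos≡A : suc (pos k + 0) ≡ A
  1+pos≡A = trans (cong suc (+-identityʳ (pos k))) (trans (+-comm 1 (pos k)) pos+1≡A)

second-of-block : ∀ k → 1 < len (w k) → pos k + 1 ≡ floorPhi (suc k) → LengthStep k → LengthStep (pos k + 1)
second-of-block k 1<len pos+1≡A step-k = begin
  len (w (pos k + 1)) + floorPhi (suc (pos k + 1)) ≡⟨ cong₂ _+_ len≡1 (cong (floorPhi ∘ suc) pos+1≡A) ⟩
  1 + floorPhi (1 + A)                             ≡⟨ cong (1 +_) (floorPhi-1+floorPhi k) ⟩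
  (2 + A) + suc k                                  ≡⟨ sym (floorPhi-2+floorPhi k next≡A+2) ⟩
  floorPhi (2 + A)                                 ≡⟨ cong (λ n → floorPhi (2 + n)) (sym pos+1≡A) ⟩
  floorPhi (2 + (pos k + 1))                       ∎
  where
  open ≡-Reasoning
  A : ℕ
  A = floorPhi (suc k)
  lenk≡2 : len (w k) ≡ 2
  lenk≡2 = ≤-antisym (len≤2 (w k)) 1<len
  len≡1 : len (w (pos k + 1)) ≡ 1
  len≡1 = trans (cong len (w-pos k 1<len)) (len-second (w k) lenk≡2)
  next≡A+2 : floorPhi (2 + k) ≡ A + 2
  next≡A+2 = trans (sym step-k) (trans (cong (_+ A) lenk≡2) (+-comm 2 A))

length-step : ∀ j → LengthStep j
length-step = <-rec LengthStep λ j steps → from-block steps (block-of j)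
  where
  from-block : ∀ {j} → (∀ {i} → i < j → LengthStep i) → InBlock j → LengthStep j
  from-block steps (k , zero , refl , _) =
    first-of-block k (pos+1≡floorPhi-below k λ i<k → steps (<-≤-trans i<k (≤-trans (≤pos k) (m≤m+n (pos k) 0))))
  from-block steps (k , suc zero , refl , 1<len) =
    second-of-block k 1<len (pos+1≡floorPhi-below k λ i<k → steps (<-trans i<k k<pos+1)) (steps k<pos+1)
    where
    k<pos+1 : k < pos k + 1
    k<pos+1 = ≤-<-trans (≤pos k) (m<m+n (pos k) (s≤s z≤n))
  from-block steps (k , suc (suc _) , _ , 2+<len) = ⊥-elim (<⇒≱ 2+<len (≤-trans (len≤2 (w k)) (s≤s (s≤s z≤n))))

pos+1≡floorPhi : ∀ k → pos k + 1 ≡ floorPhi (suc k)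
pos+1≡floorPhi k = pos+1≡floorPhi-below k λ {i} _ → length-step i

-- Windows of length 5

-- α (n + 1) = ⌊(n + 2)φ⌋ + g₄ (n + 1) (see a₄≡floorPhi), the smaller coordinate of the n-th pair.
α : ℕ → ℕ
α k = pos k + 1 + ρ₄ (w k)

αw : List Letter → ℕ → ℕ
αw u c = length (μ₄* (take c u)) + 1 + ρ₄ (nth c u)

α-factor : ∀ j {c L} → c < L → α (j + c) ≡ pos j + αw (factor j L) c
α-factor j {c} {L} c<L = begin
  pos (j + c) + 1 + ρ₄ (w (j + c))
    ≡⟨ cong₂ (λ p x → p + 1 + ρ₄ x) (pos-+ j c) (sym (nth-factor j c<L)) ⟩
  pos j + length (μ₄* (factor j c)) + 1 + ρ₄ (nth c (factor j L))
    ≡⟨ cong (λ u → pos j + length (μ₄* u) + 1 + ρ₄ (nth c (factor j L))) (sym (take-factor j (<⇒≤ c<L))) ⟩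
  pos j + length (μ₄* (take c (factor j L))) + 1 + ρ₄ (nth c (factor j L))
    ≡⟨ reassoc (pos j) _ _ ⟩
  pos j + αw (factor j L) c
    ∎
  where
  open ≡-Reasoning
  reassoc : ∀ p l r → p + l + 1 + r ≡ p + (l + 1 + r)
  reassoc = solve-∀

α-image : ∀ k n {c} → c < length (μ₄* (factor k n)) → α (pos k + c) ≡ pos k + k + αw (μ₄* (factor k n)) c
α-image k n {c} c<len = begin
  α (pos k + c)                                  ≡⟨ α-factor (pos k) c<len ⟩
  pos (pos k) + αw (factor (pos k) (length (μ₄* (factor k n)))) c
    ≡⟨ cong₂ (λ p u → p + αw u c) (pos-pos k) (sym (μ₄*-factor k n)) ⟩
  pos k + k + αw (μ₄* (factor k n)) c            ∎
  where open ≡-Reasoning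

image-window : ∀ k n {t m} → t + m ≤ length (μ₄* (factor k n)) →
               take m (drop t (μ₄* (factor k n))) ≡ factor (pos k + t) m
image-window k n {t} {m} t+m≤len = begin
  take m (drop t (μ₄* (factor k n)))          ≡⟨ cong (take m ∘ drop t) (μ₄*-factor k n) ⟩
  take m (drop t (factor (pos k) L))          ≡⟨ cong (take m) (drop-factor (pos k) (≤-trans (m≤m+n t m) t+m≤len)) ⟩
  take m (factor (pos k + t) (L ∸ t))
    ≡⟨ take-factor (pos k + t) (subst (_≤ L ∸ t) (m+n∸m≡n t m) (∸-monoˡ-≤ t t+m≤len)) ⟩
  factor (pos k + t) m                        ∎
  where
  open ≡-Reasoning
  L : ℕ
  L = length (μ₄* (factor k n))

open import Data.List.Membership.DecPropositional (List.≡-dec _≟ᴸ_) using (_∈_; _∈?_)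

-- A set of words of length 5 containing w[1, 6) and closed under v ↦ (μ₄ v)[t, t + 5) for t ∈ {0, 1}.
factors₅ : List (List Letter)
factors₅ =
  (l1 ∷ l2 ∷ l3 ∷ l4 ∷ l5 ∷ []) ∷
  (l2 ∷ l3 ∷ l4 ∷ l5 ∷ l6 ∷ []) ∷
  (l3 ∷ l4 ∷ l5 ∷ l6 ∷ l7 ∷ []) ∷
  (l4 ∷ l5 ∷ l6 ∷ l7 ∷ l8 ∷ []) ∷
  (l5 ∷ l6 ∷ l7 ∷ l8 ∷ l9 ∷ []) ∷
  (l6 ∷ l7 ∷ l8 ∷ l9 ∷ la ∷ []) ∷
  (l7 ∷ l8 ∷ l9 ∷ la ∷ lb ∷ []) ∷
  (l7 ∷ lg ∷ le ∷ l7 ∷ lg ∷ []) ∷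
  (l7 ∷ lg ∷ le ∷ lh ∷ lb ∷ []) ∷
  (l8 ∷ l9 ∷ la ∷ lb ∷ lc ∷ []) ∷
  (l9 ∷ la ∷ lb ∷ lc ∷ ld ∷ []) ∷
  (la ∷ lb ∷ lc ∷ ld ∷ lc ∷ []) ∷
  (lb ∷ lc ∷ ld ∷ lc ∷ ld ∷ []) ∷
  (lb ∷ lc ∷ ld ∷ le ∷ lh ∷ []) ∷
  (lb ∷ le ∷ lf ∷ le ∷ l7 ∷ []) ∷
  (lb ∷ le ∷ lf ∷ le ∷ lh ∷ []) ∷
  (lb ∷ le ∷ lh ∷ lb ∷ lc ∷ []) ∷
  (lb ∷ le ∷ lh ∷ lb ∷ le ∷ []) ∷
  (lc ∷ ld ∷ lc ∷ ld ∷ le ∷ []) ∷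
  (lc ∷ ld ∷ le ∷ lf ∷ le ∷ []) ∷
  (lc ∷ ld ∷ le ∷ lh ∷ lb ∷ []) ∷
  (ld ∷ lc ∷ ld ∷ le ∷ lf ∷ []) ∷
  (ld ∷ le ∷ lf ∷ le ∷ lf ∷ []) ∷
  (ld ∷ le ∷ lh ∷ lb ∷ lc ∷ []) ∷
  (ld ∷ le ∷ lh ∷ lb ∷ le ∷ []) ∷
  (le ∷ l7 ∷ lg ∷ le ∷ l7 ∷ []) ∷
  (le ∷ l7 ∷ lg ∷ le ∷ lh ∷ []) ∷
  (le ∷ lf ∷ le ∷ l7 ∷ lg ∷ []) ∷
  (le ∷ lf ∷ le ∷ lf ∷ le ∷ []) ∷
  (le ∷ lf ∷ le ∷ lh ∷ lb ∷ []) ∷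
  (le ∷ lh ∷ lb ∷ lc ∷ ld ∷ []) ∷
  (le ∷ lh ∷ lb ∷ le ∷ lf ∷ []) ∷
  (le ∷ lh ∷ lb ∷ le ∷ lh ∷ []) ∷
  (lf ∷ le ∷ l7 ∷ lg ∷ le ∷ []) ∷
  (lf ∷ le ∷ lf ∷ le ∷ l7 ∷ []) ∷
  (lf ∷ le ∷ lh ∷ lb ∷ le ∷ []) ∷
  (lg ∷ le ∷ l7 ∷ lg ∷ le ∷ []) ∷
  (lg ∷ le ∷ lh ∷ lb ∷ le ∷ []) ∷
  (lh ∷ lb ∷ lc ∷ ld ∷ le ∷ []) ∷
  (lh ∷ lb ∷ le ∷ lf ∷ le ∷ []) ∷
  (lh ∷ lb ∷ le ∷ lh ∷ lb ∷ []) ∷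
  []

-- For v = w[k, k + 5), the offsets i ∈ [len v₀, len v₀ + len v₁) of μ₄ v are the block of w (k + 1);
-- a jump of 2 of α at such a position skips exactly the value α k or α (k + 1).
GapHit : List Letter → ℕ → Set
GapHit v t = t < len (nth 1 v) →
  let i = len (nth 0 v) + t in
  2 + i < length (μ₄* v) × (αw (μ₄* v) (2 + i) ≡ αw (μ₄* v) (1 + i) + 2 → αw v 0 ≡ 1 + i ⊎ αw v 1 ≡ 1 + i)

gapHit? : ∀ v t → Dec (GapHit v t)
gapHit? v t = t <? len (nth 1 v) →-dec (2 + i <? length (μ₄* v) ×-dec
  ((αw (μ₄* v) (2 + i) ≟ αw (μ₄* v) (1 + i) + 2) →-dec (αw v 0 ≟ 1 + i ⊎-dec αw v 1 ≟ 1 + i)))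
  where
  i : ℕ
  i = len (nth 0 v) + t

-- By α-factor and α-image, for v = w[k, k + 5) the α-fields are inequalities between α k, α (k + 1),
-- α (α k), α (α k + 1) and α k + k + 4.
record Admissible (v : List Letter) : Set where
  field
    long      : 6 ≤ length (μ₄* v)
    derived₀  : take 5 (μ₄* v) ∈ factors₅
    derived₁  : take 5 (drop 1 (μ₄* v)) ∈ factors₅
    α-step    : αw v 0 < αw v 1
    α-gap     : αw v 1 ≤ αw v 0 + 2
    in-image  : suc (αw v 0) < length (μ₄* v)
    αα-below  : αw (μ₄* v) (αw v 0) < αw v 0 + 4
    αα-above  : αw v 0 + 4 < αw (μ₄* v) (suc (αw v 0))
    gap-hit₀  : GapHit v 0
    gap-hit₁  : GapHit v 1

admissible? : ∀ v → Dec (Admissible v)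
admissible? v = map′ (λ (p₁ , p₂ , p₃ , p₄ , p₅ , p₆ , p₇ , p₈ , p₉ , p₁₀) → record
                       { long = p₁ ; derived₀ = p₂ ; derived₁ = p₃ ; α-step = p₄ ; α-gap = p₅ ; in-image = p₆
                       ; αα-below = p₇ ; αα-above = p₈ ; gap-hit₀ = p₉ ; gap-hit₁ = p₁₀ })
  (λ r → let open Admissible r in
         long , derived₀ , derived₁ , α-step , α-gap , in-image , αα-below , αα-above , gap-hit₀ , gap-hit₁)
  (6 ≤? length (μ₄* v) ×-dec take 5 (μ₄* v) ∈? factors₅ ×-dec take 5 (drop 1 (μ₄* v)) ∈? factors₅ ×-dec
   αw v 0 <? αw v 1 ×-dec αw v 1 ≤? αw v 0 + 2 ×-dec suc (αw v 0) <? length (μ₄* v) ×-dec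
   αw (μ₄* v) (αw v 0) <? αw v 0 + 4 ×-dec αw v 0 + 4 <? αw (μ₄* v) (suc (αw v 0)) ×-dec
   gapHit? v 0 ×-dec gapHit? v 1)

-- Opaque, so that conversion checking never re-runs the decision procedure.
opaque
  factors₅-admissible : All Admissible factors₅
  factors₅-admissible = from-yes (all? admissible? factors₅)

factor-∈ : ∀ k → 1 ≤ k → factor k 5 ∈ factors₅
factor-∈ = <-rec (λ k → 1 ≤ k → factor k 5 ∈ factors₅) λ k IH → from-block IH (block-of k)
  where
  from-block : ∀ {j} → (∀ {i} → i < j → 1 ≤ i → factor i 5 ∈ factors₅) →
                InBlock j → 1 ≤ j → factor j 5 ∈ factors₅
  from-block IH (zero , zero , refl , _) ()
  from-block IH (zero , suc zero , refl , _) _ = from-yes (factor 1 5 ∈? factors₅)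
  from-block IH (zero , suc (suc _) , refl , (s≤s (s≤s ()))) _
  from-block IH (k@(suc k') , zero , refl , _) _ =
    subst (_∈ factors₅) (image-window k 5 (≤-trans (n≤1+n 5) long)) derived₀
    where open Admissible (All-lookup factors₅-admissible (IH (≤-trans (<pos k') (m≤m+n (pos k) 0)) (s≤s z≤n)))
  from-block IH (k@(suc k') , suc zero , refl , _) _ =
    subst (_∈ factors₅) (image-window k 5 long) derived₁
    where open Admissible (All-lookup factors₅-admissible (IH (≤-trans (<pos k') (m≤m+n (pos k) 1)) (s≤s z≤n)))
  from-block IH (k@(suc _) , suc (suc _) , refl , 2+<len) _ =
    ⊥-elim (<⇒≱ 2+<len (≤-trans (len≤2 (w k)) (s≤s (s≤s z≤n))))

admissible : ∀ k → 1 ≤ k → Admissible (factor k 5)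
admissible k 1≤k = All-lookup factors₅-admissible (factor-∈ k 1≤k)

module _ (k : ℕ) (1≤k : 1 ≤ k) where
  private
    open Admissible (admissible k 1≤k)
    v : List Letter
    v = factor k 5
    a : ℕ
    a = αw v 0

    α-k : α k ≡ pos k + a
    α-k = trans (cong α (sym (+-identityʳ k))) (α-factor k {0} {5} (s≤s z≤n))

    α-1+k : α (suc k) ≡ pos k + αw v 1
    α-1+k = trans (cong α (+-comm 1 k)) (α-factor k {1} {5} (s≤s (s≤s z≤n)))

    α-α-k : ∀ {c} → c < length (μ₄* v) → α (pos k + c) ≡ pos k + k + αw (μ₄* v) c
    α-α-k = α-image k 5

    shift : ∀ p k a → p + k + (a + 4) ≡ p + a + k + 4
    shift = solve-∀

  α-mono : α k < α (suc k)
  α-mono = subst₂ _<_ (sym α-k) (sym α-1+k) (+-monoʳ-< (pos k) α-step)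

  α-gap≤2 : α (suc k) ≤ α k + 2
  α-gap≤2 = subst₂ _≤_ (sym α-1+k) (trans (sym (+-assoc (pos k) a 2)) (cong (_+ 2) (sym α-k))) (+-monoʳ-≤ (pos k) α-gap)

  α∘α-below : α (α k) < α k + k + 4
  α∘α-below = begin-strict
    α (α k)                        ≡⟨ trans (cong α α-k) (α-α-k (<-trans (n<1+n a) in-image)) ⟩
    pos k + k + αw (μ₄* v) a       <⟨ +-monoʳ-< (pos k + k) αα-below ⟩
    pos k + k + (a + 4)            ≡⟨ shift (pos k) k a ⟩
    pos k + a + k + 4              ≡⟨ cong (λ n → n + k + 4) (sym α-k) ⟩
    α k + k + 4                    ∎
    where open ≤-Reasoning

  α∘α-above : α k + k + 4 < α (suc (α k))
  α∘α-above = begin-strict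
    α k + k + 4                    ≡⟨ cong (λ n → n + k + 4) α-k ⟩
    pos k + a + k + 4              ≡⟨ sym (shift (pos k) k a) ⟩
    pos k + k + (a + 4)            <⟨ +-monoʳ-< (pos k + k) αα-above ⟩
    pos k + k + αw (μ₄* v) (suc a) ≡⟨ sym (α-α-k in-image) ⟩
    α (pos k + suc a)              ≡⟨ cong α (trans (+-suc (pos k) a) (cong suc (sym α-k))) ⟩
    α (suc (α k))                  ∎
    where open ≤-Reasoning

  α-gap-hit-window : ∀ {t} → t < len (w (suc k)) → α (2 + (pos (suc k) + t)) ≡ α (1 + (pos (suc k) + t)) + 2 →
                     α k ≡ 1 + (pos (suc k) + t) ⊎ α (suc k) ≡ 1 + (pos (suc k) + t)
  α-gap-hit-window {t} t<len gap =
    ⊎-map (λ a≡ → trans α-k (trans (cong (pos k +_) a≡) (sym j+1≡)))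
          (λ a≡ → trans α-1+k (trans (cong (pos k +_) a≡) (sym j+1≡)))
          (proj₂ (gapHit t t<len) gap-in-image)
    where
    gapHit : ∀ t → GapHit v t
    gapHit zero = gap-hit₀
    gapHit (suc zero) = gap-hit₁
    gapHit (suc (suc _)) 2+<len = ⊥-elim (<⇒≱ 2+<len (≤-trans (len≤2 (w (suc k))) (s≤s (s≤s z≤n))))
    i : ℕ
    i = len (w k) + t
    2+i<len : 2 + i < length (μ₄* v)
    2+i<len = proj₁ (gapHit t t<len)
    shift-j : ∀ c p l t → c + (p + l + t) ≡ p + (c + (l + t))
    shift-j = solve-∀
    j+1≡ : 1 + (pos (suc k) + t) ≡ pos k + (1 + i)
    j+1≡ = shift-j 1 (pos k) (len (w k)) t
    gap-in-image : αw (μ₄* v) (2 + i) ≡ αw (μ₄* v) (1 + i) + 2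
    gap-in-image = +-cancelˡ-≡ (pos k + k) _ _ (begin
      pos k + k + αw (μ₄* v) (2 + i)     ≡⟨ sym (α-α-k 2+i<len) ⟩
      α (pos k + (2 + i))                ≡⟨ cong α (sym (shift-j 2 (pos k) (len (w k)) t)) ⟩
      α (2 + (pos (suc k) + t))          ≡⟨ gap ⟩
      α (1 + (pos (suc k) + t)) + 2      ≡⟨ cong (λ n → α n + 2) j+1≡ ⟩
      α (pos k + (1 + i)) + 2            ≡⟨ cong (_+ 2) (α-α-k (<-trans (n<1+n (1 + i)) 2+i<len)) ⟩
      pos k + k + αw (μ₄* v) (1 + i) + 2 ≡⟨ +-assoc (pos k + k) _ 2 ⟩
      pos k + k + (αw (μ₄* v) (1 + i) + 2) ∎)
      where open ≡-Reasoning

α-gap-hit : ∀ j → α (2 + j) ≡ α (1 + j) + 2 → ∃[ n ] α (suc n) ≡ suc j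
α-gap-hit j gap = from-block gap (block-of j)
  where
  from-block : ∀ {j} → α (2 + j) ≡ α (1 + j) + 2 → InBlock j → ∃[ n ] α (suc n) ≡ suc j
  from-block () (zero , zero , refl , _)
  from-block () (zero , suc zero , refl , _)
  from-block _ (zero , suc (suc _) , refl , s≤s (s≤s ()))
  from-block () (suc zero , zero , refl , _)
  from-block _ (suc zero , suc _ , refl , s≤s ())
  from-block gap (suc (suc k) , t , refl , t<len) =
    [ (λ α≡ → k , α≡) , (λ α≡ → suc k , α≡) ]′ (α-gap-hit-window (suc k) (s≤s z≤n) t<len gap)

a₄ : ℕ → ℕ
a₄ n = α (suc n)

a₄-mono : ∀ n → a₄ n < a₄ (suc n)
a₄-mono n = α-mono (suc n) (s≤s z≤n)

module K₄ = WythoffPairs 4 a₄ a₄-mono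

b₄≡ : ∀ n → a₄ n + suc n + 4 ≡ K₄.b n
b₄≡ n = shift (a₄ n) n
  where
  shift : ∀ a n → a + suc n + 4 ≡ a + n + 5
  shift = solve-∀

b₄-below : ∀ n → a₄ (pred (a₄ n)) < K₄.b n
b₄-below n = subst₂ _<_ (cong α (sym (suc-pred (a₄ n) {{>-nonZero 0<a₄}}))) (b₄≡ n) (α∘α-below (suc n) (s≤s z≤n))
  where
  0<a₄ : 0 < a₄ n
  0<a₄ = ≤-trans (m≤n+m 1 (pos (suc n))) (m≤m+n _ _)

b₄-above : ∀ n → K₄.b n < a₄ (a₄ n)
b₄-above n = subst (_< a₄ (a₄ n)) (b₄≡ n) (α∘α-above (suc n) (s≤s z≤n))

a₄-gap≤2 : ∀ j → a₄ (suc j) ≤ a₄ j + 2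
a₄-gap≤2 j = α-gap≤2 (suc j) (s≤s z≤n)

module L₄ = K₄.Local refl b₄-below b₄-above a₄-gap≤2 α-gap-hit
module G₄ = K₄.Game ≤-refl L₄.a≢b L₄.cover

a₄≡floorPhi : ∀ n → a₄ n ≡ floorPhi (n + 2) + g₄ (n + 1)
a₄≡floorPhi n = cong₂ _+_ (trans (pos+1≡floorPhi (suc n)) (cong floorPhi (+-comm 2 n))) (cong (ρ₄ ∘ fixpt) (+-comm 1 n))

b₄≡floorPhi2 : ∀ n → K₄.b n ≡ floorPhi2 (n + 2) + g₄ (n + 1) + 3
b₄≡floorPhi2 n = begin
  a₄ n + n + 5                               ≡⟨ cong (λ a → a + n + 5) (a₄≡floorPhi n) ⟩
  floorPhi (n + 2) + g₄ (n + 1) + n + 5      ≡⟨ regroup (floorPhi (n + 2)) (g₄ (n + 1)) n ⟩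
  floorPhi (n + 2) + (n + 2) + g₄ (n + 1) + 3 ≡⟨ cong (λ f → f + g₄ (n + 1) + 3) (sym (floorPhi2≡floorPhi+ (n + 2))) ⟩
  floorPhi2 (n + 2) + g₄ (n + 1) + 3         ∎
  where
  open ≡-Reasoning
  regroup : ∀ f g n → f + g + n + 5 ≡ f + (n + 2) + g + 3
  regroup = solve-∀

theorem14 : ∀ (a b : ℕ) → a ≤ b →
    (IsP 4 a b ⇔ (a + b ≤ 4 ⊎
      (∃[ n ] (a ≡ floorPhi (n + 2) + g₄ (n + 1) ×
               b ≡ floorPhi2 (n + 2) + g₄ (n + 1) + 3))))
theorem14 x y x≤y = ⇔-trans (G₄.IsP⇔pair x y x≤y) (mk⇔ (map₂ to) (map₂ from))
  where
  to : ∃[ n ] x ≡ a₄ n × y ≡ K₄.b n →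
       ∃[ n ] x ≡ floorPhi (n + 2) + g₄ (n + 1) × y ≡ floorPhi2 (n + 2) + g₄ (n + 1) + 3
  to (n , x≡ , y≡) = n , trans x≡ (a₄≡floorPhi n) , trans y≡ (b₄≡floorPhi2 n)
  from : ∃[ n ] x ≡ floorPhi (n + 2) + g₄ (n + 1) × y ≡ floorPhi2 (n + 2) + g₄ (n + 1) + 3 →
         ∃[ n ] x ≡ a₄ n × y ≡ K₄.b n
  from (n , x≡ , y≡) = n , trans x≡ (sym (a₄≡floorPhi n)) , trans y≡ (sym (b₄≡floorPhi2 n))
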